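{- For every positive integer $n \equiv 1 \pmod{7}$, there is no binary LCD $[n,3,\lfloor 4n/7 \rfloor]$ code.
   Context: All codes are binary linear codes; an $[n,k,d]$ code is a $k$-dimensional subspace of $\mathbb{F}_2^n$ with minimum nonzero Hamming weight $d$. A code $C$ is LCD if $C \cap C^\perp = \{\mathbf{0}_n\}$, where $C^\perp$ is the dual with respect to the standard inner product. -}

module Defs where

open import Data.Bool using (Bool; true; false; _xor_; _∧_; if_then_else_)
open import Data.Nat using (ℕ; zero; suc; _+_; _≤_)
open import Data.Vec using (Vec; []; _∷_; replicate; zipWith; foldr)
open import Data.Product using (Σ; _×_; ∃; ∃-syntax; _,_)
open import Relation.Binary.PropositionalEquality using (_≡_; _≢_)

-- Binary words of length n: vectors over F₂ = Bool (false = 0, true = 1).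
Word : ℕ → Set
Word n = Vec Bool n

0w : {n : ℕ} → Word n
0w {n} = replicate n false

_⊕_ : {n : ℕ} → Word n → Word n → Word n
_⊕_ = zipWith _xor_

wt : {n : ℕ} → Word n → ℕ
wt [] = 0
wt (b ∷ v) = (if b then 1 else 0) + wt v

_·_ : {n : ℕ} → Word n → Word n → Bool
u · v = foldr _ _xor_ false (zipWith _∧_ u v)

Code : ℕ → Set₁
Code n = Word n → Set

-- Linear code: a subspace of F₂ⁿ (over F₂, closure under + and 0 suffices).
record IsLinear {n : ℕ} (C : Code n) : Set where
  field
    has-0 : C 0w
    closed-⊕ : ∀ u v → C u → C v → C (u ⊕ v)

lincomb : {n k : ℕ} → Vec Bool k → Vec (Word n) k → Word n
lincomb [] [] = 0w
lincomb (true ∷ m) (b ∷ B) = b ⊕ lincomb m B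
lincomb (false ∷ m) (b ∷ B) = lincomb m B

LinearlyIndependent : {n k : ℕ} → Vec (Word n) k → Set
LinearlyIndependent {n} {k} B = ∀ m → lincomb m B ≡ 0w → m ≡ replicate k false

HasDimension : {n : ℕ} → Code n → ℕ → Set
HasDimension {n} C k =
  Σ (Vec (Word n) k) λ B →
    LinearlyIndependent B × (∀ c → (C c → ∃[ m ] lincomb m B ≡ c) × (∃[ m ] lincomb m B ≡ c → C c))

HasMinDistance : {n : ℕ} → Code n → ℕ → Set
HasMinDistance C d =
  (∀ c → C c → c ≢ 0w → d ≤ wt c) × (∃[ c ] (C c × c ≢ 0w × wt c ≡ d))

Dual : {n : ℕ} → Code n → Code n
Dual C v = ∀ c → C c → v · c ≡ false

IsLCD : {n : ℕ} → Code n → Set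
IsLCD C = ∀ v → C v → Dual C v → v ≡ 0w

Is[_,_,_]-code : (n k d : ℕ) → Code n → Set
Is[ n , k , d ]-code C = IsLinear C × HasDimension C k × HasMinDistance C d

{-# OPTIONS --safe #-}
module Submission where

-- Write n = 7m + 1, so that d = 4m. For a basis b₁, b₂, b₃ of C, every nonzero column of the
-- generator matrix is met by exactly four of the seven nonzero codewords, so their weights add
-- up to 4·|supp C| ≤ 28m + 4. Each weight is at least 4m, hence the seven excesses over 4m add
-- up to 0 or 4. Over F₂ the Gram matrix of the basis depends only on the weights modulo 4
-- (b · b ≡ wt b mod 2, and b · b′ = 1 iff wt b + wt b′ ≡ wt (b + b′) + 2 mod 4), and the parity
-- of the weight is a linear functional on C. Checking the finitely many admissible excess
-- vectors shows that the Gram matrix is always singular; a nonzero vector in its kernel gives a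
-- nonzero codeword orthogonal to all of C.

open import Defs
open import Algebra.Bundles using (CommutativeRing)
open import Data.Bool using (Bool; true; false; not; _xor_; _∧_; _∨_; if_then_else_)
import Data.Bool.Properties as Bool
open import Data.Bool.Properties using (xor-∧-commutativeRing; xor-identityʳ; ∧-distribʳ-xor; ∧-idem; ∧-comm)
open import Data.Fin.Subset.Properties using (anySubset?)
open import Data.List using (List; _++_) renaming ([] to []ˡ; _∷_ to _∷ˡ_; map to mapˡ)
open import Data.List.Membership.Propositional using (_∈_)
open import Data.List.Membership.Propositional.Properties using (∈-map⁺; ∈-++⁺ˡ; ∈-++⁺ʳ)
open import Data.List.Relation.Unary.Any using (here)
import Data.List.Relation.Unary.All as ListAll
open import Data.Nat using (ℕ; zero; suc; _+_; _*_; _∸_; _≥_; _≤_; _<_; z≤n; s≤s; _%_; _/_; _≟_)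
open import Data.Nat.Divisibility using (divides-refl)
open import Data.Nat.DivMod using (m≡m%n+[m/n]*n; [m+kn]%n≡m%n; %-distribˡ-+; m%n<n; m*n/n≡m; +-distrib-/-∣ʳ)
open import Data.Nat.Properties
  using (+-suc; +-identityʳ; *-comm; *-distribˡ-+; +-cancelˡ-≡; m+[n∸m]≡n; m≤n⇒m≤1+n; +-commutativeSemigroup)
open import Data.Nat.Tactic.RingSolver using (solve-∀)
open import Data.Product using (_×_; ∃-syntax; _,_; proj₁; proj₂)
open import Data.Sum using (_⊎_; inj₁; inj₂)
open import Data.Vec using (Vec; []; _∷_; replicate; zipWith; map; sum; foldr₁)
open import Data.Vec.Properties using (≡-dec; map-cong; map-const; map-∘; zipWith-idem)
open import Data.Vec.Relation.Unary.All using (All; []; _∷_)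
import Data.Vec.Relation.Unary.All as VecAll
open import Data.Vec.Relation.Unary.All.Properties using (map⁺)
open import Function using (_∘_)
open import Relation.Binary.PropositionalEquality using (_≡_; _≢_; refl; sym; trans; cong; cong₂; subst; module ≡-Reasoning)
open import Relation.Nullary using (¬_; Dec; does; _×-dec_; _→-dec_; ¬?)
open import Relation.Nullary.Decidable using (dec-true; dec-false; toWitness)
open import Algebra.Properties.CommutativeSemigroup (CommutativeRing.+-commutativeSemigroup xor-∧-commutativeRing)
  using () renaming (interchange to xor-interchange)
open import Algebra.Properties.CommutativeSemigroup +-commutativeSemigroup
  using () renaming (interchange to +-interchange)

odd : ℕ → Bool
odd 0 = false
odd 1 = true
odd (suc (suc n)) = odd n

odd-suc : ∀ n → odd (suc n) ≡ not (odd n)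
odd-suc 0 = refl
odd-suc 1 = refl
odd-suc (suc (suc n)) = odd-suc n

odd-+ : ∀ m n → odd (m + n) ≡ odd m xor odd n
odd-+ 0 n = refl
odd-+ 1 n = odd-suc n
odd-+ (suc (suc m)) n = odd-+ m n

odd-double : ∀ n → odd (n + n) ≡ false
odd-double 0 = refl
odd-double (suc n) rewrite +-suc n n = odd-double n

odd-m*4+n : ∀ m n → odd (m * 4 + n) ≡ odd n
odd-m*4+n zero n = refl
odd-m*4+n (suc m) n = odd-m*4+n m n

sum-zipWith-+ : ∀ {k} (xs ys : Vec ℕ k) → sum (zipWith _+_ xs ys) ≡ sum xs + sum ys
sum-zipWith-+ [] [] = refl
sum-zipWith-+ (x ∷ xs) (y ∷ ys) = trans (cong (x + y +_) (sum-zipWith-+ xs ys)) (+-interchange x y (sum xs) (sum ys))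

sum-map-+ : ∀ {k} q (xs : Vec ℕ k) → sum (map (q +_) xs) ≡ k * q + sum xs
sum-map-+ q [] = refl
sum-map-+ q (x ∷ xs) = trans (cong (q + x +_) (sum-map-+ q xs)) (+-interchange q x _ (sum xs))

map-+-∸ : ∀ {k} q {xs : Vec ℕ k} → All (q ≤_) xs → map (q +_) (map (_∸ q) xs) ≡ xs
map-+-∸ q [] = refl
map-+-∸ q (q≤x ∷ q≤xs) = cong₂ _∷_ (m+[n∸m]≡n q≤x) (map-+-∸ q q≤xs)

wt-0w : ∀ n → wt (0w {n}) ≡ 0
wt-0w zero = refl
wt-0w (suc n) = wt-0w n

wt≤length : ∀ {n} (u : Word n) → wt u ≤ n
wt≤length [] = z≤n
wt≤length (true ∷ u) = s≤s (wt≤length u)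
wt≤length (false ∷ u) = m≤n⇒m≤1+n (wt≤length u)

⊕-identityʳ : ∀ {n} (u : Word n) → u ⊕ 0w ≡ u
⊕-identityʳ [] = refl
⊕-identityʳ (x ∷ u) = cong₂ _∷_ (xor-identityʳ x) (⊕-identityʳ u)

·-zeroˡ : ∀ {n} (u : Word n) → 0w · u ≡ false
·-zeroˡ [] = refl
·-zeroˡ (_ ∷ u) = ·-zeroˡ u

·-zeroʳ : ∀ {n} (u : Word n) → u · 0w ≡ false
·-zeroʳ [] = refl
·-zeroʳ (true ∷ u) = ·-zeroʳ u
·-zeroʳ (false ∷ u) = ·-zeroʳ u

·-comm : ∀ {n} (u v : Word n) → u · v ≡ v · u
·-comm [] [] = refl
·-comm (x ∷ u) (y ∷ v) = cong₂ _xor_ (∧-comm x y) (·-comm u v)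

·-distribʳ-⊕ : ∀ {n} (w u v : Word n) → (u ⊕ v) · w ≡ (u · w) xor (v · w)
·-distribʳ-⊕ [] [] [] = refl
·-distribʳ-⊕ (z ∷ w) (x ∷ u) (y ∷ v) = begin
  ((x xor y) ∧ z) xor ((u ⊕ v) · w)               ≡⟨ cong₂ _xor_ (∧-distribʳ-xor z x y) (·-distribʳ-⊕ w u v) ⟩
  ((x ∧ z) xor (y ∧ z)) xor ((u · w) xor (v · w)) ≡⟨ xor-interchange (x ∧ z) (y ∧ z) (u · w) (v · w) ⟩
  ((x ∧ z) xor (u · w)) xor ((y ∧ z) xor (v · w)) ∎
  where open ≡-Reasoning

map-·-⊕ : ∀ {n k} (u v : Word n) (B : Vec (Word n) k) → map (u ·_) B ⊕ map (v ·_) B ≡ map ((u ⊕ v) ·_) B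
map-·-⊕ u v [] = refl
map-·-⊕ u v (b ∷ B) = cong₂ _∷_ (sym (·-distribʳ-⊕ b u v)) (map-·-⊕ u v B)

·-lincombʳ : ∀ {n k} (v : Word n) (s : Vec Bool k) (B : Vec (Word n) k) → v · lincomb s B ≡ s · map (v ·_) B
·-lincombʳ v [] [] = ·-zeroʳ v
·-lincombʳ v (true ∷ s) (b ∷ B) = begin
  v · (b ⊕ lincomb s B)          ≡⟨ ·-comm v _ ⟩
  (b ⊕ lincomb s B) · v          ≡⟨ ·-distribʳ-⊕ v b _ ⟩
  (b · v) xor (lincomb s B · v)  ≡⟨ cong₂ _xor_ (·-comm b v) (trans (·-comm _ v) (·-lincombʳ v s B)) ⟩
  (v · b) xor (s · map (v ·_) B) ∎
  where open ≡-Reasoning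
·-lincombʳ v (false ∷ s) (b ∷ B) = ·-lincombʳ v s B

lincomb-map-· : ∀ {n j k} (r : Vec Bool k) (A : Vec (Word n) k) (B : Vec (Word n) j) →
  lincomb r (map (λ a → map (a ·_) B) A) ≡ map (lincomb r A ·_) B
lincomb-map-· [] [] B = sym (trans (map-cong ·-zeroˡ B) (map-const B false))
lincomb-map-· (true ∷ r) (a ∷ A) B =
  trans (cong (map (a ·_) B ⊕_) (lincomb-map-· r A B)) (map-·-⊕ a (lincomb r A) B)
lincomb-map-· (false ∷ r) (a ∷ A) B = lincomb-map-· r A B

·≡odd-wt-∧ : ∀ {n} (u v : Word n) → u · v ≡ odd (wt (zipWith _∧_ u v))
·≡odd-wt-∧ [] [] = refl
·≡odd-wt-∧ (x ∷ u) (y ∷ v) with x ∧ y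
... | true = trans (cong not (·≡odd-wt-∧ u v)) (sym (odd-suc (wt (zipWith _∧_ u v))))
... | false = ·≡odd-wt-∧ u v

·-self : ∀ {n} (u : Word n) → u · u ≡ odd (wt u)
·-self u = trans (·≡odd-wt-∧ u u) (cong (odd ∘ wt) (zipWith-idem ∧-idem u))

wt-⊕ : ∀ {n} (u v : Word n) → let o = wt (zipWith _∧_ u v) in wt (u ⊕ v) + (o + o) ≡ wt u + wt v
wt-⊕ [] [] = refl
wt-⊕ (true ∷ u) (true ∷ v) = trans (lhs _ _) (trans (cong (2 +_) (wt-⊕ u v)) (sym (rhs (wt u) (wt v))))
  where
  lhs : ∀ w o → w + (suc o + suc o) ≡ 2 + (w + (o + o))
  lhs = solve-∀
  rhs : ∀ a b → suc a + suc b ≡ 2 + (a + b)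
  rhs = solve-∀
wt-⊕ (true ∷ u) (false ∷ v) = cong suc (wt-⊕ u v)
wt-⊕ (false ∷ u) (true ∷ v) = trans (cong suc (wt-⊕ u v)) (sym (+-suc (wt u) (wt v)))
wt-⊕ (false ∷ u) (false ∷ v) = wt-⊕ u v

odd-wt-⊕ : ∀ {n} (u v : Word n) → odd (wt (u ⊕ v)) ≡ odd (wt u) xor odd (wt v)
odd-wt-⊕ u v = begin
  odd (wt (u ⊕ v))                 ≡⟨ sym (xor-identityʳ _) ⟩
  odd (wt (u ⊕ v)) xor false       ≡⟨ cong (odd (wt (u ⊕ v)) xor_) (sym (odd-double o)) ⟩
  odd (wt (u ⊕ v)) xor odd (o + o) ≡⟨ sym (odd-+ (wt (u ⊕ v)) (o + o)) ⟩
  odd (wt (u ⊕ v) + (o + o))       ≡⟨ cong odd (wt-⊕ u v) ⟩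
  odd (wt u + wt v)                ≡⟨ odd-+ (wt u) (wt v) ⟩
  odd (wt u) xor odd (wt v)        ∎
  where
  open ≡-Reasoning
  o : ℕ
  o = wt (zipWith _∧_ u v)

odd-wt-lincomb : ∀ {n k} (r : Vec Bool k) (B : Vec (Word n) k) → odd (wt (lincomb r B)) ≡ r · map (odd ∘ wt) B
odd-wt-lincomb {n} [] [] = cong odd (wt-0w n)
odd-wt-lincomb (true ∷ r) (b ∷ B) = trans (odd-wt-⊕ b _) (cong (odd (wt b) xor_) (odd-wt-lincomb r B))
odd-wt-lincomb (false ∷ r) (b ∷ B) = odd-wt-lincomb r B

gramEntry : ℕ → ℕ → ℕ → Bool
gramEntry a b c = does ((a + b) % 4 ≟ (c + 2) % 4)

m%4≢[m+2]%4 : ∀ m → m % 4 ≢ (m + 2) % 4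
m%4≢[m+2]%4 m eq = distinct (m%n<n m 4) (trans eq (%-distribˡ-+ m 2 4))
  where
  distinct : ∀ {r} → r < 4 → r ≢ (r + 2) % 4
  distinct {0} _ ()
  distinct {1} _ ()
  distinct {2} _ ()
  distinct {3} _ ()
  distinct {suc (suc (suc (suc _)))} (s≤s (s≤s (s≤s (s≤s ()))))

[w+o+o]%4≟[w+2]%4≡odd : ∀ w o → does ((w + (o + o)) % 4 ≟ (w + 2) % 4) ≡ odd o
[w+o+o]%4≟[w+2]%4≡odd w 0 =
  dec-false (_ ≟ _) (λ eq → m%4≢[m+2]%4 w (trans (cong (_% 4) (sym (+-identityʳ w))) eq))
[w+o+o]%4≟[w+2]%4≡odd w 1 = dec-true ((w + 2) % 4 ≟ (w + 2) % 4) refl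
[w+o+o]%4≟[w+2]%4≡odd w (suc (suc o)) = begin
  does ((w + (suc (suc o) + suc (suc o))) % 4 ≟ (w + 2) % 4) ≡⟨ cong (λ x → does (x % 4 ≟ (w + 2) % 4)) (shift w o) ⟩
  does ((w + (o + o) + 1 * 4) % 4 ≟ (w + 2) % 4)             ≡⟨ cong (λ x → does (x ≟ (w + 2) % 4)) ([m+kn]%n≡m%n (w + (o + o)) 1 4) ⟩
  does ((w + (o + o)) % 4 ≟ (w + 2) % 4)                     ≡⟨ [w+o+o]%4≟[w+2]%4≡odd w o ⟩
  odd o                                                      ∎
  where
  open ≡-Reasoning
  shift : ∀ w o → w + (suc (suc o) + suc (suc o)) ≡ w + (o + o) + 1 * 4
  shift = solve-∀

·≡gramEntry : ∀ {n} (u v : Word n) → u · v ≡ gramEntry (wt u) (wt v) (wt (u ⊕ v))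
·≡gramEntry u v = begin
  u · v                                                    ≡⟨ ·≡odd-wt-∧ u v ⟩
  odd o                                                    ≡⟨ sym ([w+o+o]%4≟[w+2]%4≡odd (wt (u ⊕ v)) o) ⟩
  does ((wt (u ⊕ v) + (o + o)) % 4 ≟ (wt (u ⊕ v) + 2) % 4) ≡⟨ cong (λ x → does (x % 4 ≟ (wt (u ⊕ v) + 2) % 4)) (wt-⊕ u v) ⟩
  gramEntry (wt u) (wt v) (wt (u ⊕ v))                     ∎
  where
  open ≡-Reasoning
  o : ℕ
  o = wt (zipWith _∧_ u v)

gramEntry-shift : ∀ m a b c → gramEntry (m * 4 + a) (m * 4 + b) (m * 4 + c) ≡ gramEntry a b c
gramEntry-shift m a b c = cong₂ (λ x y → does (x ≟ y))
  (trans (cong (_% 4) (lhs m a b)) ([m+kn]%n≡m%n (a + b) (m + m) 4))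
  (trans (cong (_% 4) (rhs m c)) ([m+kn]%n≡m%n (c + 2) m 4))
  where
  lhs : ∀ m a b → m * 4 + a + (m * 4 + b) ≡ a + b + (m + m) * 4
  lhs = solve-∀
  rhs : ∀ m c → m * 4 + c + 2 ≡ c + 2 + m * 4
  rhs = solve-∀

gram : ∀ {n k} → Vec (Word n) k → Vec (Word k) k
gram B = map (λ b → map (b ·_) B) B

LinearlyDependent : ∀ {n k} → Vec (Word n) k → Set
LinearlyDependent {n} {k} B = ∃[ r ] r ≢ replicate k false × lincomb r B ≡ 0w

linearlyDependent? : ∀ {n k} (B : Vec (Word n) k) → Dec (LinearlyDependent B)
linearlyDependent? {k = k} B =
  anySubset? (λ r → ¬? (≡-dec Bool._≟_ r (replicate k false)) ×-dec ≡-dec Bool._≟_ (lincomb r B) 0w)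

dependent-gram⇒¬LCD : ∀ {n k} {C : Code n} (dim : HasDimension C k) → LinearlyDependent (gram (proj₁ dim)) → ¬ IsLCD C
dependent-gram⇒¬LCD {n} {C = C} (B , independent , spans) (r , r≢0 , rG≡0) lcd = r≢0 (independent r (lcd v v∈C v∈C⊥))
  where
  v : Word n
  v = lincomb r B
  v∈C : C v
  v∈C = proj₂ (spans v) (r , refl)
  v⊥B : map (v ·_) B ≡ 0w
  v⊥B = trans (sym (lincomb-map-· r B B)) rG≡0
  v∈C⊥ : Dual C v
  v∈C⊥ c c∈C with proj₁ (spans c) c∈C
  ... | s , refl = trans (·-lincombʳ v s B) (trans (cong (s ·_) v⊥B) (·-zeroʳ s))

nonzero₃ : Vec (Word 3) 7
nonzero₃ = (true ∷ false ∷ false ∷ []) ∷ (false ∷ true ∷ false ∷ []) ∷ (false ∷ false ∷ true ∷ [])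
  ∷ (true ∷ true ∷ false ∷ []) ∷ (true ∷ false ∷ true ∷ []) ∷ (false ∷ true ∷ true ∷ [])
  ∷ (true ∷ true ∷ true ∷ []) ∷ []

weights : ∀ {n} → Vec (Word n) 3 → Vec ℕ 7
weights B = map (λ r → wt (lincomb r B)) nonzero₃

weights-≥ : ∀ {n d} {C : Code n} (dim : HasDimension C 3) → HasMinDistance C d → All (d ≤_) (weights (proj₁ dim))
weights-≥ {d = d} (B , independent , spans) (minimal , _) = map⁺ (VecAll.map (λ {r} r≢0 → at-least r r≢0) nonzero)
  where
  nonzero : All (_≢ replicate 3 false) nonzero₃
  nonzero = (λ ()) ∷ (λ ()) ∷ (λ ()) ∷ (λ ()) ∷ (λ ()) ∷ (λ ()) ∷ (λ ()) ∷ []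
  at-least : ∀ r → r ≢ replicate 3 false → d ≤ wt (lincomb r B)
  at-least r r≢0 = minimal _ (proj₂ (spans _) (r , refl)) (r≢0 ∘ independent r)

support : ∀ {n k} → Vec (Word n) (suc k) → Word n
support = foldr₁ (zipWith _∨_)

column-hits : ∀ x y z → sum (map (λ r → if r · (x ∷ y ∷ z ∷ []) then 1 else 0) nonzero₃) ≡ 4 * (if x ∨ y ∨ z then 1 else 0)
column-hits true true true = refl
column-hits true true false = refl
column-hits true false true = refl
column-hits true false false = refl
column-hits false true true = refl
column-hits false true false = refl
column-hits false false true = refl
column-hits false false false = refl

sum-weights≡4*wt-support : ∀ {n} (B : Vec (Word n) 3) → sum (weights B) ≡ 4 * wt (support B)
sum-weights≡4*wt-support ([] ∷ [] ∷ [] ∷ []) = refl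
sum-weights≡4*wt-support {suc n} ((x ∷ u) ∷ (y ∷ v) ∷ (z ∷ w) ∷ []) = begin
  sum (weights ((x ∷ u) ∷ (y ∷ v) ∷ (z ∷ w) ∷ []))      ≡⟨ sum-zipWith-+ hits (weights B) ⟩
  sum hits + sum (weights B)                            ≡⟨ cong₂ _+_ (column-hits x y z) (sum-weights≡4*wt-support B) ⟩
  4 * (if x ∨ y ∨ z then 1 else 0) + 4 * wt (support B) ≡⟨ sym (*-distribˡ-+ 4 (if x ∨ y ∨ z then 1 else 0) (wt (support B))) ⟩
  4 * wt (support ((x ∷ u) ∷ (y ∷ v) ∷ (z ∷ w) ∷ []))  ∎
  where
  open ≡-Reasoning
  B : Vec (Word n) 3
  B = u ∷ v ∷ w ∷ []
  hits : Vec ℕ 7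
  hits = map (λ r → if r · (x ∷ y ∷ z ∷ []) then 1 else 0) nonzero₃

gramOfWeights : Vec ℕ 7 → Vec (Word 3) 3
gramOfWeights (w₁ ∷ w₂ ∷ w₃ ∷ w₁₂ ∷ w₁₃ ∷ w₂₃ ∷ _ ∷ []) =
  (odd w₁ ∷ g₁₂ ∷ g₁₃ ∷ []) ∷ (g₁₂ ∷ odd w₂ ∷ g₂₃ ∷ []) ∷ (g₁₃ ∷ g₂₃ ∷ odd w₃ ∷ []) ∷ []
  where
  g₁₂ g₁₃ g₂₃ : Bool
  g₁₂ = gramEntry w₁ w₂ w₁₂
  g₁₃ = gramEntry w₁ w₃ w₁₃
  g₂₃ = gramEntry w₂ w₃ w₂₃

gram≡gramOfWeights : ∀ {n} (B : Vec (Word n) 3) → gram B ≡ gramOfWeights (weights B)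
gram≡gramOfWeights (b₁ ∷ b₂ ∷ b₃ ∷ []) rewrite ⊕-identityʳ b₁ | ⊕-identityʳ b₂ | ⊕-identityʳ b₃ =
  vec₃ (vec₃ (·-self b₁) (·≡gramEntry b₁ b₂) (·≡gramEntry b₁ b₃))
       (vec₃ (transposed b₁ b₂) (·-self b₂) (·≡gramEntry b₂ b₃))
       (vec₃ (transposed b₁ b₃) (transposed b₂ b₃) (·-self b₃))
  where
  vec₃ : ∀ {A : Set} {a a′ b b′ c c′ : A} → a ≡ a′ → b ≡ b′ → c ≡ c′ → _≡_ {A = Vec A 3} (a ∷ b ∷ c ∷ []) (a′ ∷ b′ ∷ c′ ∷ [])
  vec₃ a≡ b≡ c≡ = cong₂ _∷_ a≡ (cong₂ _∷_ b≡ (cong₂ _∷_ c≡ refl))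
  transposed : ∀ {n} (u v : Word n) → v · u ≡ gramEntry (wt u) (wt v) (wt (u ⊕ v))
  transposed u v = trans (·-comm v u) (·≡gramEntry u v)

gramOfWeights-shift : ∀ m ws → gramOfWeights (map (m * 4 +_) ws) ≡ gramOfWeights ws
gramOfWeights-shift m (w₁ ∷ w₂ ∷ w₃ ∷ w₁₂ ∷ w₁₃ ∷ w₂₃ ∷ _ ∷ [])
  rewrite odd-m*4+n m w₁ | odd-m*4+n m w₂ | odd-m*4+n m w₃
        | gramEntry-shift m w₁ w₂ w₁₂ | gramEntry-shift m w₁ w₃ w₁₃ | gramEntry-shift m w₂ w₃ w₂₃ = refl

ParityLinear : Vec ℕ 7 → Set
ParityLinear ws = ∃[ ℓ ] map odd ws ≡ map (_· ℓ) nonzero₃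

parityLinear? : ∀ ws → Dec (ParityLinear ws)
parityLinear? ws = anySubset? (λ ℓ → ≡-dec Bool._≟_ (map odd ws) (map (_· ℓ) nonzero₃))

parityLinear-weights : ∀ {n} (B : Vec (Word n) 3) → ParityLinear (weights B)
parityLinear-weights B =
  map (odd ∘ wt) B , trans (sym (map-∘ odd (λ r → wt (lincomb r B)) nonzero₃)) (map-cong (λ r → odd-wt-lincomb r B) nonzero₃)

parityLinear-unshift : ∀ m ws → ParityLinear (map (m * 4 +_) ws) → ParityLinear ws
parityLinear-unshift m ws (ℓ , eq) =
  ℓ , trans (sym (map-cong (odd-m*4+n m) ws)) (trans (map-∘ odd (m * 4 +_) ws) eq)

compositions : (k s : ℕ) → List (Vec ℕ k)
compositions zero zero = [] ∷ˡ []ˡ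
compositions zero (suc s) = []ˡ
compositions (suc k) zero = mapˡ (0 ∷_) (compositions k zero)
compositions (suc k) (suc s) = mapˡ (0 ∷_) (compositions k (suc s)) ++ mapˡ suc-head (compositions (suc k) s)
  where
  suc-head : Vec ℕ (suc k) → Vec ℕ (suc k)
  suc-head (x ∷ xs) = suc x ∷ xs

∈-compositions : ∀ {k} (xs : Vec ℕ k) → xs ∈ compositions k (sum xs)
∈-compositions [] = here refl
∈-compositions (x ∷ xs) = ∷-∈-compositions x xs
  where
  zero-∷-∈ : ∀ {k} {xs : Vec ℕ k} s → xs ∈ compositions k s → 0 ∷ xs ∈ compositions (suc k) s
  zero-∷-∈ zero xs∈ = ∈-map⁺ (0 ∷_) xs∈
  zero-∷-∈ (suc s) xs∈ = ∈-++⁺ˡ (∈-map⁺ (0 ∷_) xs∈)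
  ∷-∈-compositions : ∀ {k} x (xs : Vec ℕ k) → x ∷ xs ∈ compositions (suc k) (x + sum xs)
  ∷-∈-compositions zero xs = zero-∷-∈ (sum xs) (∈-compositions xs)
  ∷-∈-compositions (suc x) xs = ∈-++⁺ʳ _ (∈-map⁺ _ (∷-∈-compositions x xs))

small-excess⇒dependent-gram : ∀ es → sum es ≡ 0 ⊎ sum es ≡ 4 → ParityLinear es → LinearlyDependent (gramOfWeights es)
small-excess⇒dependent-gram es sum≡ = ListAll.lookup (checked sum≡) (∈-compositions es)
  where
  SingularIfParityLinear : Vec ℕ 7 → Set
  SingularIfParityLinear es = ParityLinear es → LinearlyDependent (gramOfWeights es)
  singularIfParityLinear? : ∀ es → Dec (SingularIfParityLinear es)
  singularIfParityLinear? es = parityLinear? es →-dec linearlyDependent? (gramOfWeights es)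
  checked : ∀ {s} → s ≡ 0 ⊎ s ≡ 4 → ListAll.All SingularIfParityLinear (compositions 7 s)
  checked (inj₁ refl) = toWitness {a? = ListAll.all? singularIfParityLinear? (compositions 7 0)} _
  checked (inj₂ refl) = toWitness {a? = ListAll.all? singularIfParityLinear? (compositions 7 4)} _

T*4+s≡t*4⇒s≡0⊎4 : ∀ T t s → T * 4 + s ≡ t * 4 → t ≤ suc T → s ≡ 0 ⊎ s ≡ 4
T*4+s≡t*4⇒s≡0⊎4 zero zero s eq _ = inj₁ eq
T*4+s≡t*4⇒s≡0⊎4 zero (suc zero) s eq _ = inj₂ eq
T*4+s≡t*4⇒s≡0⊎4 zero (suc (suc t)) s eq (s≤s ())
T*4+s≡t*4⇒s≡0⊎4 (suc T) zero s () _
T*4+s≡t*4⇒s≡0⊎4 (suc T) (suc t) s eq (s≤s t≤T) = T*4+s≡t*4⇒s≡0⊎4 T t s (+-cancelˡ-≡ 4 _ _ eq) t≤T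

n≡1+[n/7]*7 : ∀ n → n % 7 ≡ 1 → n ≡ 1 + n / 7 * 7
n≡1+[n/7]*7 n n%7≡1 = trans (m≡m%n+[m/n]*n n 7) (cong (_+ n / 7 * 7) n%7≡1)

[4*[1+m*7]]/7≡m*4 : ∀ m → (4 * (1 + m * 7)) / 7 ≡ m * 4
[4*[1+m*7]]/7≡m*4 m = trans (cong (_/ 7) (expand m)) (trans (+-distrib-/-∣ʳ 4 {d = 7} (divides-refl (m * 4))) (m*n/n≡m (m * 4) 7))
  where
  expand : ∀ m → 4 * (1 + m * 7) ≡ 4 + m * 4 * 7
  expand = solve-∀

excess-sum≡0⊎4 : ∀ {n} m (B : Vec (Word n) 3) es → n ≡ 1 + m * 7 → map (m * 4 +_) es ≡ weights B →
  sum es ≡ 0 ⊎ sum es ≡ 4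
excess-sum≡0⊎4 m B es n≡ weights≡ =
  T*4+s≡t*4⇒s≡0⊎4 (m * 7) t (sum es) total (subst (t ≤_) n≡ (wt≤length (support B)))
  where
  t : ℕ
  t = wt (support B)
  regroup : ∀ m s → (m * 7) * 4 + s ≡ 7 * (m * 4) + s
  regroup = solve-∀
  total : (m * 7) * 4 + sum es ≡ t * 4
  total = begin
    (m * 7) * 4 + sum es       ≡⟨ regroup m (sum es) ⟩
    7 * (m * 4) + sum es       ≡⟨ sym (sum-map-+ (m * 4) es) ⟩
    sum (map (m * 4 +_) es)    ≡⟨ cong sum weights≡ ⟩
    sum (weights B)            ≡⟨ sum-weights≡4*wt-support B ⟩
    4 * t                      ≡⟨ *-comm 4 t ⟩
    t * 4                      ∎
    where open ≡-Reasoning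

lemma5p6 : (n : ℕ) → n ≥ 1 → n % 7 ≡ 1 →
    ¬ (∃[ C ] (Is[ n , 3 , (4 * n) / 7 ]-code C × IsLCD C))
lemma5p6 n _ n%7≡1 (C , (_ , dim@(B , _) , distance) , lcd) =
  dependent-gram⇒¬LCD dim (subst LinearlyDependent gram≡ singular) lcd
  where
  m : ℕ
  m = n / 7
  n≡ : n ≡ 1 + m * 7
  n≡ = n≡1+[n/7]*7 n n%7≡1
  es : Vec ℕ 7
  es = map (_∸ m * 4) (weights B)
  weights≡ : map (m * 4 +_) es ≡ weights B
  weights≡ = map-+-∸ (m * 4) (subst (λ d → All (d ≤_) (weights B))
    (trans (cong (λ x → (4 * x) / 7) n≡) ([4*[1+m*7]]/7≡m*4 m)) (weights-≥ dim distance))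
  gram≡ : gramOfWeights es ≡ gram B
  gram≡ = sym (trans (gram≡gramOfWeights B) (trans (cong gramOfWeights (sym weights≡)) (gramOfWeights-shift m es)))
  parity : ParityLinear es
  parity = parityLinear-unshift m es (subst ParityLinear (sym weights≡) (parityLinear-weights B))
  singular : LinearlyDependent (gramOfWeights es)
  singular = small-excess⇒dependent-gram es (excess-sum≡0⊎4 m B es n≡ weights≡) parity
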